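{- Let $G=(V,E)$ be a connected undirected graph with positive resistances $r$, Laplacian $\mathbf{L}$, and supply $\mathbf{b}$ with $\sum_i b(i)=0$; let $\mathbf{p}^*$ satisfy $\mathbf{L}\mathbf{p}^*=\mathbf{b}$, and let $T$ be a spanning tree. Suppose that in an iteration of Algorithm Dual KOSZ, starting from potentials $\mathbf{p}^t$, the tree edge $(i,j)\in T$ is sampled with probability $P_{ij}=\frac{1}{\tau}\frac{r(i,j)}{R(C(i,j))}$, producing $\mathbf{p}^{t+1}$. Then $$\mathcal{B}(\mathbf{p}^*)-\mathbb{E}[\mathcal{B}(\mathbf{p}^{t+1})]\le\Big(1-\frac1\tau\Big)\big(\mathcal{B}(\mathbf{p}^*)-\mathcal{B}(\mathbf{p}^t)\big),$$ where the expectation is over the sampled edge given $\mathbf{p}^t$.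
   Context: $\mathbf{L}=\sum_{ij\in E}\frac{1}{r(i,j)}(\mathbf{e}_i-\mathbf{e}_j)(\mathbf{e}_i-\mathbf{e}_j)^\top$ and $\mathcal{B}(\mathbf{p})=2\mathbf{b}^\top\mathbf{p}-\mathbf{p}^\top\mathbf{L}\mathbf{p}$. For $(i,j)\in T$, $C(i,j)$ is the vertex set of the component of $T-ij$ containing $i$. For $C\subset V$: $\delta(C)$ is the set of edges with exactly one endpoint in $C$, $S(C)=\sum_{v\in C}b(v)$, $R(C)=\big(\sum_{kl\in\delta(C)}1/r(k,l)\big)^{ -1}$, and $f(C)=\sum_{kl\in E,\,k\in C,\,l\notin C}\frac{p^t(k)-p^t(l)}{r(k,l)}$. $\tau=\sum_{(i,j)\in T}\frac{r(i,j)}{R(C(i,j))}$. An iteration of Algorithm Dual KOSZ with sampled edge $(i,j)$ sets $C=C(i,j)$, $\Delta=(S(C)-f(C))R(C)$, and $\mathbf{p}^{t+1}=\mathbf{p}^t+\Delta\mathbbm{1}_C$.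
   Formalization: The resistances r, the supply $\mathbf{b}$ and the potentials $\mathbf{p}^*$, $\mathbf{p}^t$ take values in ℚ rather than ℝ. -}

module Defs where

open import Data.Nat using (ℕ; zero; suc)
open import Data.Fin using (Fin; zero; suc; _≟_)
open import Data.Bool using (Bool; true; false; if_then_else_; not; _∧_)
open import Data.Rational using (ℚ; 0ℚ; 1ℚ; _+_; _*_; _-_; 1/_; ≢-nonZero)
open import Data.Rational.Properties using () renaming (_≟_ to _≟ℚ_)
open import Data.Product using (_×_)
open import Data.Sum using (_⊎_)
open import Relation.Nullary using (yes; no; ⌊_⌋)
open import Relation.Binary.PropositionalEquality using (_≡_)

Σ : ∀ {n} → (Fin n → ℚ) → ℚ
Σ {zero}  f = 0ℚ
Σ {suc n} f = f zero + Σ (λ i → f (suc i))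

-- Total reciprocal: 1/q for q ≠ 0, and 0 for q = 0.  It is only ever
-- applied to quantities that are positive under the hypotheses.
inv : ℚ → ℚ
inv q with q ≟ℚ 0ℚ
... | yes _ = 0ℚ
... | no q≢0 = 1/_ q {{≢-nonZero q≢0}}

𝟙 : Bool → ℚ
𝟙 b = if b then 1ℚ else 0ℚ

record Graph (n m : ℕ) : Set where
  field
    u v : Fin m → Fin n
    r   : Fin m → ℚ
open Graph public

EdgeSet : ℕ → Set
EdgeSet m = Fin m → Bool

allEdges : ∀ {m} → EdgeSet m
allEdges _ = true

remove : ∀ {m} → EdgeSet m → Fin m → EdgeSet m
remove S k l = if ⌊ l ≟ k ⌋ then false else S l

Joins : ∀ {n m} → Graph n m → Fin m → Fin n → Fin n → Set
Joins G k x y = (u G k ≡ x × v G k ≡ y) ⊎ (v G k ≡ x × u G k ≡ y)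

data Reach {n m} (G : Graph n m) (S : EdgeSet m) (x : Fin n) : Fin n → Set where
  here : Reach G S x x
  step : ∀ {y z} (k : Fin m) → Reach G S x y → S k ≡ true → Joins G k y z → Reach G S x z

Connected : ∀ {n m} → Graph n m → Set
Connected G = ∀ x y → Reach G allEdges x y

-- T ⊆ E is a spanning tree of G: it spans (connects all vertices) and is
-- acyclic, i.e. no edge of T lies on a cycle of T (removing any edge of T
-- disconnects its endpoints).
SpanningTree : ∀ {n m} → Graph n m → EdgeSet m → Set
SpanningTree G T =
  (∀ x y → Reach G T x y) ×
  (∀ k → T k ≡ true → Reach G (remove T k) (u G k) (v G k) → Data.Empty.⊥)
  where import Data.Empty

-- C k is the vertex set (as an indicator) of the component of T - k
-- containing the endpoint u k, for the tree edge k oriented as (u k, v k).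
IsComponentMap : ∀ {n m} → Graph n m → EdgeSet m → (Fin m → Fin n → Bool) → Set
IsComponentMap G T C =
  ∀ k → T k ≡ true → ∀ w →
    (C k w ≡ true → Reach G (remove T k) (u G k) w) ×
    (Reach G (remove T k) (u G k) w → C k w ≡ true)

module _ {n m : ℕ} (G : Graph n m) where

  cond : Fin m → ℚ
  cond k = inv (r G k)

  incid : Fin m → Fin n → ℚ
  incid k w = 𝟙 ⌊ w ≟ u G k ⌋ - 𝟙 ⌊ w ≟ v G k ⌋

  Lap : Fin n → Fin n → ℚ
  Lap w w' = Σ (λ k → cond k * (incid k w * incid k w'))

  Lmul : (Fin n → ℚ) → Fin n → ℚ
  Lmul p w = Σ (λ w' → Lap w w' * p w')

  dot : (Fin n → ℚ) → (Fin n → ℚ) → ℚ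
  dot x y = Σ (λ w → x w * y w)

  𝓑 : (Fin n → ℚ) → (Fin n → ℚ) → ℚ
  𝓑 b p = (1ℚ + 1ℚ) * dot b p - dot p (Lmul p)

  inδ : (Fin n → Bool) → Fin m → Bool
  inδ C k = (C (u G k) ∧ not (C (v G k))) Data.Bool.∨ (C (v G k) ∧ not (C (u G k)))
    where import Data.Bool

  S : (Fin n → ℚ) → (Fin n → Bool) → ℚ
  S b C = Σ (λ w → 𝟙 (C w) * b w)

  R : (Fin n → Bool) → ℚ
  R C = inv (Σ (λ k → 𝟙 (inδ C k) * cond k))

  flow : (Fin n → ℚ) → (Fin n → Bool) → ℚ
  flow p C = Σ (λ k →
      𝟙 (C (u G k) ∧ not (C (v G k))) * ((p (u G k) - p (v G k)) * cond k)
    + 𝟙 (C (v G k) ∧ not (C (u G k))) * ((p (v G k) - p (u G k)) * cond k))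

  module _ (T : EdgeSet m) (C : Fin m → Fin n → Bool) where

    τ : ℚ
    τ = Σ (λ k → 𝟙 (T k) * (r G k * inv (R (C k))))

    P : Fin m → ℚ
    P k = 𝟙 (T k) * (inv τ * (r G k * inv (R (C k))))

    Δ : (b p : Fin n → ℚ) → Fin m → ℚ
    Δ b p k = (S b (C k) - flow p (C k)) * R (C k)

    update : (b p : Fin n → ℚ) → Fin m → Fin n → ℚ
    update b p k w = p w + Δ b p k * 𝟙 (C k w)

    expectedB : (b p : Fin n → ℚ) → ℚ
    expectedB b p = Σ (λ k → P k * 𝓑 b (update b p k))

{-# OPTIONS --safe #-}
-- With x = p* − p, the gap B(p*) − B(p) is the energy E(x,x) = Σ_e (x(u e) − x(v e))² / r(e),
-- and B(p + Δ 1_C) is a quadratic in Δ whose maximiser Δ = (S(C) − f(C)) R(C) raises B by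
-- φ² R(C), where φ = S(C) − f(C) = E(1_C, x).  Hence E[B(p')] = B(p) + τ⁻¹ Σ_{k∈T} r(k) φ_k²,
-- and it remains to show E(x,x) ≤ Σ_{k∈T} r(k) φ_k².  Up to a constant, x is the sum over tree
-- edges k of its drop a_k along k times 1_{C(k)}; so E(x,x) = Σ_{k∈T} a_k φ_k.  Termwise AM-GM,
-- 2 a φ ≤ a²/r + r φ², together with Σ_{k∈T} a_k²/r(k) ≤ E(x,x), gives 2E(x,x) ≤ E(x,x) + Σ r φ².
module Submission where

open import Defs
open import Data.Nat using (ℕ)
open import Data.Fin using (Fin)
open import Data.Bool using (Bool)
open import Data.Rational using (ℚ; 0ℚ; 1ℚ; _-_; _*_; _≤_; _<_)
open import Data.Product using (_×_)
open import Relation.Nullary using (¬_)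
open import Relation.Binary.PropositionalEquality using (_≡_; _≢_)

open import Algebra.Bundles using (CommutativeRing; CommutativeMonoid)
open import Data.Bool using (true; false; _∧_; _∨_; not)
import Data.Bool.Properties as Bool
open import Data.Empty using (⊥-elim)
open import Data.Fin using (zero; suc) renaming (_≟_ to _≟ᶠ_)
open import Data.Fin.Properties using (suc-injective; any?)
open import Data.List using (_∷_; [])
import Data.Maybe as Maybe
open import Data.Product using (_,_; proj₁; proj₂; ∃)
open import Data.Rational using (_+_; -_; Positive; ≢-nonZero; positive; nonNegative; nonPositive)
open import Data.Rational.Properties
open import Data.Sum using (_⊎_; inj₁; inj₂)
open import Function using (_∘_; mk⇔)
open import Level using (0ℓ)
open import Relation.Binary.PropositionalEquality
  using (refl; sym; trans; cong; cong₂; subst; module ≡-Reasoning)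
open import Relation.Nullary using (yes; no; ⌊_⌋; contradiction)
open import Relation.Nullary.Decidable using (dec⇒maybe)
open import Tactic.RingSolver using (solve-∀; solve)
open import Tactic.RingSolver.Core.AlmostCommutativeRing
  using (AlmostCommutativeRing; fromCommutativeRing)
open import Algebra.Properties.CommutativeSemigroup
  (CommutativeMonoid.commutativeSemigroup *-1-commutativeMonoid)
  using (x∙yz≈y∙xz; xy∙z≈xz∙y; xy∙z≈x∙zy)
open import Algebra.Properties.Ring +-*-ring using (x[y-z]≈xy-xz)
import Algebra.Properties.Semiring.Sum (CommutativeRing.semiring +-*-commutativeRing)
  as SemiringSum

ℚ-ring : AlmostCommutativeRing 0ℓ 0ℓ
ℚ-ring = fromCommutativeRing +-*-commutativeRing
  (λ q → Maybe.map sym (dec⇒maybe (q ≟ 0ℚ)))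

two : ℚ
two = 1ℚ + 1ℚ

*-nonNeg : ∀ {p q} → 0ℚ ≤ p → 0ℚ ≤ q → 0ℚ ≤ p * q
*-nonNeg {p} {q} 0≤p 0≤q =
  nonNegative⁻¹ _ {{nonNeg*nonNeg⇒nonNeg p {{nonNegative 0≤p}} q {{nonNegative 0≤q}}}}

square-nonNeg : ∀ p → 0ℚ ≤ p * p
square-nonNeg p with ≤-total 0ℚ p
... | inj₁ 0≤p = *-nonNeg 0≤p 0≤p
... | inj₂ p≤0 =
  nonNegative⁻¹ _ {{nonPos*nonPos⇒nonPos p {{nonPositive p≤0}} p {{nonPositive p≤0}}}}

+-cancelˡ-≤ : ∀ r {p q} → r + p ≤ r + q → p ≤ q
+-cancelˡ-≤ r {p} {q} r+p≤r+q = begin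
  p              ≡⟨ solve (r ∷ p ∷ []) ℚ-ring ⟩
  - r + (r + p)  ≤⟨ +-monoʳ-≤ (- r) r+p≤r+q ⟩
  - r + (r + q)  ≡⟨ solve (r ∷ q ∷ []) ℚ-ring ⟩
  q              ∎
  where open ≤-Reasoning

0≤q-p⇒p≤q : ∀ {p q} → 0ℚ ≤ q - p → p ≤ q
0≤q-p⇒p≤q {p} {q} 0≤q-p = begin
  p            ≡⟨ solve (p ∷ []) ℚ-ring ⟩
  0ℚ + p       ≤⟨ +-monoˡ-≤ p 0≤q-p ⟩
  (q - p) + p  ≡⟨ solve (p ∷ q ∷ []) ℚ-ring ⟩
  q            ∎
  where open ≤-Reasoning

am-gm : ∀ {r c} → r * c ≡ 1ℚ → 0ℚ ≤ r → ∀ a φ → two * (a * φ) ≤ c * (a * a) + r * (φ * φ)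
am-gm {r} {c} rc≡1 0≤r a φ =
  0≤q-p⇒p≤q (subst (0ℚ ≤_) difference (*-nonNeg 0≤r (square-nonNeg (c * a - φ))))
  where
  open ≡-Reasoning
  difference : r * ((c * a - φ) * (c * a - φ)) ≡ (c * (a * a) + r * (φ * φ)) - two * (a * φ)
  difference = begin
    r * ((c * a - φ) * (c * a - φ))
      ≡⟨ solve (r ∷ c ∷ a ∷ φ ∷ []) ℚ-ring ⟩
    (r * c) * (c * (a * a)) - (r * c) * (two * (a * φ)) + r * (φ * φ)
      ≡⟨ cong (λ z → z * (c * (a * a)) - z * (two * (a * φ)) + r * (φ * φ)) rc≡1 ⟩
    1ℚ * (c * (a * a)) - 1ℚ * (two * (a * φ)) + r * (φ * φ)
      ≡⟨ solve (r ∷ c ∷ a ∷ φ ∷ []) ℚ-ring ⟩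
    (c * (a * a) + r * (φ * φ)) - two * (a * φ) ∎

contraction : ∀ {ι q x} → 0ℚ ≤ ι → q ≤ x → q - ι * x ≤ (1ℚ - ι) * q
contraction {ι} {q} {x} 0≤ι q≤x = begin
  q - ι * x  ≤⟨ +-monoʳ-≤ q (neg-antimono-≤ (*-monoˡ-≤-nonNeg ι {{nonNegative 0≤ι}} q≤x)) ⟩
  q - ι * q  ≡⟨ solve (ι ∷ q ∷ []) ℚ-ring ⟩
  (1ℚ - ι) * q ∎
  where open ≤-Reasoning

*-pos : ∀ {p q} → 0ℚ < p → 0ℚ < q → 0ℚ < p * q
*-pos {p} {q} 0<p 0<q = positive⁻¹ _ {{pos*pos⇒pos p {{positive 0<p}} q {{positive 0<q}}}}

swap-middle : ∀ a b c d → a - b ≡ c - d → a - c ≡ b - d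
swap-middle a b c d a-b≡c-d = begin
  a - c              ≡⟨ solve (a ∷ b ∷ c ∷ []) ℚ-ring ⟩
  (a - b) + (b - c)  ≡⟨ cong (_+ (b - c)) a-b≡c-d ⟩
  (c - d) + (b - c)  ≡⟨ solve (b ∷ c ∷ d ∷ []) ℚ-ring ⟩
  b - d              ∎
  where open ≡-Reasoning

𝟙-nonNeg : ∀ t → 0ℚ ≤ 𝟙 t
𝟙-nonNeg true  = <⇒≤ (positive⁻¹ 1ℚ)
𝟙-nonNeg false = ≤-refl

𝟙-*-≤ : ∀ t {q} → 0ℚ ≤ q → 𝟙 t * q ≤ q
𝟙-*-≤ true  {q} _   = ≤-reflexive (*-identityˡ q)
𝟙-*-≤ false {q} 0≤q = ≤-trans (≤-reflexive (*-zeroˡ q)) 0≤q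

inv-inverseˡ : ∀ {q} → q ≢ 0ℚ → inv q * q ≡ 1ℚ
inv-inverseˡ {q} q≢0 with q ≟ 0ℚ
... | yes q≡0 = contradiction q≡0 q≢0
... | no q≢0′ = *-inverseˡ q {{≢-nonZero q≢0′}}

inv-pos : ∀ {q} → 0ℚ < q → 0ℚ < inv q
inv-pos {q} 0<q with q ≟ 0ℚ
... | yes q≡0 = contradiction (sym q≡0) (<⇒≢ 0<q)
... | no _ = positive⁻¹ _ {{1/pos⇒pos q {{positive 0<q}}}}

inv-nonNeg : ∀ {q} → 0ℚ ≤ q → 0ℚ ≤ inv q
inv-nonNeg {q} 0≤q with q ≟ 0ℚ
... | yes _ = ≤-refl
... | no q≢0 = <⇒≤ (positive⁻¹ _ {{1/pos⇒pos q {{q>0}}}})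
  where
  q>0 : Positive q
  q>0 = nonNeg∧nonZero⇒pos q {{nonNegative 0≤q}} {{≢-nonZero q≢0}}

Σ≡sum : ∀ {n} (f : Fin n → ℚ) → Σ f ≡ SemiringSum.sum f
Σ≡sum {ℕ.zero}  f = refl
Σ≡sum {ℕ.suc n} f = cong (f zero +_) (Σ≡sum (f ∘ suc))

Σ-cong : ∀ {n} {f g : Fin n → ℚ} → (∀ i → f i ≡ g i) → Σ f ≡ Σ g
Σ-cong {n} {f} {g} f≗g rewrite Σ≡sum f | Σ≡sum g = SemiringSum.sum-cong-≗ f≗g

Σ-distrib-+ : ∀ {n} (f g : Fin n → ℚ) → Σ (λ i → f i + g i) ≡ Σ f + Σ g
Σ-distrib-+ f g rewrite Σ≡sum (λ i → f i + g i) | Σ≡sum f | Σ≡sum g =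
  SemiringSum.∑-distrib-+ f g

*-distribˡ-Σ : ∀ {n} c (f : Fin n → ℚ) → c * Σ f ≡ Σ (λ i → c * f i)
*-distribˡ-Σ c f rewrite Σ≡sum (λ i → c * f i) | Σ≡sum f = SemiringSum.*-distribˡ-sum c f

*-distribʳ-Σ : ∀ {n} c (f : Fin n → ℚ) → Σ f * c ≡ Σ (λ i → f i * c)
*-distribʳ-Σ c f rewrite Σ≡sum (λ i → f i * c) | Σ≡sum f = SemiringSum.*-distribʳ-sum c f

Σ-comm : ∀ {m n} (f : Fin m → Fin n → ℚ) →
         Σ (λ i → Σ (λ j → f i j)) ≡ Σ (λ j → Σ (λ i → f i j))
Σ-comm f = begin
  Σ (λ i → Σ (λ j → f i j))                        ≡⟨ Σ≡sum² f ⟩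
  SemiringSum.sum (λ i → SemiringSum.sum (f i))     ≡⟨ SemiringSum.∑-comm f ⟩
  SemiringSum.sum (λ j → SemiringSum.sum (λ i → f i j)) ≡⟨ Σ≡sum² (λ j i → f i j) ⟨
  Σ (λ j → Σ (λ i → f i j))                        ∎
  where
  open ≡-Reasoning
  Σ≡sum² : ∀ {m n} (g : Fin m → Fin n → ℚ) →
           Σ (λ i → Σ (g i)) ≡ SemiringSum.sum (λ i → SemiringSum.sum (g i))
  Σ≡sum² g = trans (Σ≡sum (λ i → Σ (g i))) (SemiringSum.sum-cong-≗ (λ i → Σ≡sum (g i)))

Σ-linear : ∀ {n} (f g : Fin n → ℚ) c → Σ (λ i → f i + c * g i) ≡ Σ f + c * Σ g
Σ-linear f g c =
  trans (Σ-distrib-+ f (λ i → c * g i)) (cong (Σ f +_) (sym (*-distribˡ-Σ c g)))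

Σ-distrib-- : ∀ {n} (f g : Fin n → ℚ) → Σ (λ i → f i - g i) ≡ Σ f - Σ g
Σ-distrib-- {ℕ.zero}  f g = refl
Σ-distrib-- {ℕ.suc n} f g =
  trans (cong ((f zero - g zero) +_) (Σ-distrib-- (f ∘ suc) (g ∘ suc)))
        (regroup (f zero) (g zero) (Σ (f ∘ suc)) (Σ (g ∘ suc)))
  where
  regroup : ∀ a b c d → (a - b) + (c - d) ≡ (a + c) - (b + d)
  regroup = solve-∀ ℚ-ring

Σ-zero : ∀ {n} {f : Fin n → ℚ} → (∀ i → f i ≡ 0ℚ) → Σ f ≡ 0ℚ
Σ-zero {ℕ.zero}  _   = refl
Σ-zero {ℕ.suc n} f≡0 = cong₂ _+_ (f≡0 zero) (Σ-zero (f≡0 ∘ suc))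

Σ-single : ∀ {n} (f : Fin n → ℚ) j → (∀ i → i ≢ j → f i ≡ 0ℚ) → Σ f ≡ f j
Σ-single f zero f≡0 =
  trans (cong (f zero +_) (Σ-zero (λ i → f≡0 (suc i) λ ()))) (+-identityʳ (f zero))
Σ-single f (suc j) f≡0 =
  trans (cong₂ _+_ (f≡0 zero λ ()) (Σ-single (f ∘ suc) j (λ i i≢j → f≡0 (suc i) (i≢j ∘ suc-injective))))
        (+-identityˡ (f (suc j)))

Σ-mono-≤ : ∀ {n} {f g : Fin n → ℚ} → (∀ i → f i ≤ g i) → Σ f ≤ Σ g
Σ-mono-≤ {ℕ.zero}  _   = ≤-refl
Σ-mono-≤ {ℕ.suc n} f≤g = +-mono-≤ (f≤g zero) (Σ-mono-≤ (f≤g ∘ suc))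

Σ-nonNeg : ∀ {n} {f : Fin n → ℚ} → (∀ i → 0ℚ ≤ f i) → 0ℚ ≤ Σ f
Σ-nonNeg {ℕ.zero}  _   = ≤-refl
Σ-nonNeg {ℕ.suc n} 0≤f = +-mono-≤ (0≤f zero) (Σ-nonNeg (0≤f ∘ suc))

summand≤Σ : ∀ {n} {f : Fin n → ℚ} → (∀ i → 0ℚ ≤ f i) → ∀ j → f j ≤ Σ f
summand≤Σ {f = f} 0≤f zero = begin
  f zero               ≡⟨ +-identityʳ (f zero) ⟨
  f zero + 0ℚ          ≤⟨ +-monoʳ-≤ (f zero) (Σ-nonNeg (0≤f ∘ suc)) ⟩
  f zero + Σ (f ∘ suc) ∎
  where open ≤-Reasoning
summand≤Σ {f = f} 0≤f (suc j) = begin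
  f (suc j)            ≤⟨ summand≤Σ (0≤f ∘ suc) j ⟩
  Σ (f ∘ suc)          ≡⟨ +-identityˡ (Σ (f ∘ suc)) ⟨
  0ℚ + Σ (f ∘ suc)     ≤⟨ +-monoˡ-≤ (Σ (f ∘ suc)) (0≤f zero) ⟩
  f zero + Σ (f ∘ suc) ∎
  where open ≤-Reasoning

𝟙-≟-refl : ∀ {n} (a : Fin n) → 𝟙 ⌊ a ≟ᶠ a ⌋ ≡ 1ℚ
𝟙-≟-refl a with a ≟ᶠ a
... | yes _   = refl
... | no a≢a = contradiction refl a≢a

𝟙-≟-≢ : ∀ {n} {w a : Fin n} → w ≢ a → 𝟙 ⌊ w ≟ᶠ a ⌋ ≡ 0ℚ
𝟙-≟-≢ {w = w} {a} w≢a with w ≟ᶠ a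
... | yes w≡a = contradiction w≡a w≢a
... | no _    = refl

Σ-pick : ∀ {n} (x : Fin n → ℚ) a → Σ (λ w → x w * 𝟙 ⌊ w ≟ᶠ a ⌋) ≡ x a
Σ-pick x a = begin
  Σ (λ w → x w * 𝟙 ⌊ w ≟ᶠ a ⌋)  ≡⟨ Σ-single _ a off-a ⟩
  x a * 𝟙 ⌊ a ≟ᶠ a ⌋             ≡⟨ cong (x a *_) (𝟙-≟-refl a) ⟩
  x a * 1ℚ                       ≡⟨ *-identityʳ (x a) ⟩
  x a                            ∎
  where
  open ≡-Reasoning
  off-a : ∀ w → w ≢ a → x w * 𝟙 ⌊ w ≟ᶠ a ⌋ ≡ 0ℚ
  off-a w w≢a = trans (cong (x w *_) (𝟙-≟-≢ w≢a)) (*-zeroʳ (x w))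

-- Energy of potentials

flow-summand : ∀ a b (pu pv c : ℚ) →
  𝟙 (a ∧ not b) * ((pu - pv) * c) + 𝟙 (b ∧ not a) * ((pv - pu) * c) ≡ c * ((𝟙 a - 𝟙 b) * (pu - pv))
flow-summand true  true  = solve-∀ ℚ-ring
flow-summand true  false = solve-∀ ℚ-ring
flow-summand false true  = solve-∀ ℚ-ring
flow-summand false false = solve-∀ ℚ-ring

cut-summand : ∀ a b (c : ℚ) →
  𝟙 ((a ∧ not b) ∨ (b ∧ not a)) * c ≡ c * ((𝟙 a - 𝟙 b) * (𝟙 a - 𝟙 b))
cut-summand true  true  = solve-∀ ℚ-ring
cut-summand true  false = solve-∀ ℚ-ring
cut-summand false true  = solve-∀ ℚ-ring
cut-summand false false = solve-∀ ℚ-ring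

module Energy {n m : ℕ} (G : Graph n m) where

  grad : (Fin n → ℚ) → Fin m → ℚ
  grad x k = x (u G k) - x (v G k)

  energyAt : (Fin n → ℚ) → (Fin n → ℚ) → Fin m → ℚ
  energyAt x y k = cond G k * (grad x k * grad y k)

  energy : (Fin n → ℚ) → (Fin n → ℚ) → ℚ
  energy x y = Σ (energyAt x y)

  𝟙[_] : (Fin n → Bool) → Fin n → ℚ
  𝟙[ A ] w = 𝟙 (A w)

  -- 1/R(A) in the paper: R G A unfolds to inv (cutConductance A).
  cutConductance : (Fin n → Bool) → ℚ
  cutConductance A = Σ (λ k → 𝟙 (inδ G A k) * cond G k)

  Σ-incid : ∀ x k → Σ (λ w → x w * incid G k w) ≡ grad x k
  Σ-incid x k = begin
    Σ (λ w → x w * incid G k w)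
      ≡⟨ Σ-cong (λ w → x[y-z]≈xy-xz (x w) (𝟙 ⌊ w ≟ᶠ u G k ⌋) (𝟙 ⌊ w ≟ᶠ v G k ⌋)) ⟩
    Σ (λ w → x w * 𝟙 ⌊ w ≟ᶠ u G k ⌋ - x w * 𝟙 ⌊ w ≟ᶠ v G k ⌋)
      ≡⟨ Σ-distrib-- (λ w → x w * 𝟙 ⌊ w ≟ᶠ u G k ⌋) (λ w → x w * 𝟙 ⌊ w ≟ᶠ v G k ⌋) ⟩
    Σ (λ w → x w * 𝟙 ⌊ w ≟ᶠ u G k ⌋) - Σ (λ w → x w * 𝟙 ⌊ w ≟ᶠ v G k ⌋)
      ≡⟨ cong₂ _-_ (Σ-pick x (u G k)) (Σ-pick x (v G k)) ⟩
    grad x k ∎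
    where open ≡-Reasoning

  Σ-incid-swap : ∀ x (F : Fin m → ℚ) →
    Σ (λ w → x w * Σ (λ k → F k * incid G k w)) ≡ Σ (λ k → F k * grad x k)
  Σ-incid-swap x F = begin
    Σ (λ w → x w * Σ (λ k → F k * incid G k w))
      ≡⟨ Σ-cong (λ w → *-distribˡ-Σ (x w) (λ k → F k * incid G k w)) ⟩
    Σ (λ w → Σ (λ k → x w * (F k * incid G k w)))
      ≡⟨ Σ-comm (λ w k → x w * (F k * incid G k w)) ⟩
    Σ (λ k → Σ (λ w → x w * (F k * incid G k w)))
      ≡⟨ Σ-cong (λ k → Σ-cong (λ w → x∙yz≈y∙xz (x w) (F k) (incid G k w))) ⟩
    Σ (λ k → Σ (λ w → F k * (x w * incid G k w)))
      ≡⟨ Σ-cong (λ k → *-distribˡ-Σ (F k) (λ w → x w * incid G k w)) ⟨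
    Σ (λ k → F k * Σ (λ w → x w * incid G k w))
      ≡⟨ Σ-cong (λ k → cong (F k *_) (Σ-incid x k)) ⟩
    Σ (λ k → F k * grad x k) ∎
    where open ≡-Reasoning

  Lmul≡Σ-grad : ∀ y w → Lmul G y w ≡ Σ (λ k → (cond G k * incid G k w) * grad y k)
  Lmul≡Σ-grad y w = begin
    Σ (λ w′ → Lap G w w′ * y w′)
      ≡⟨ Σ-cong (λ w′ → trans (*-comm (Lap G w w′) (y w′)) (cong (y w′ *_) (Σ-cong (reassoc w′)))) ⟩
    Σ (λ w′ → y w′ * Σ (λ k → (cond G k * incid G k w) * incid G k w′))
      ≡⟨ Σ-incid-swap y (λ k → cond G k * incid G k w) ⟩
    Σ (λ k → (cond G k * incid G k w) * grad y k) ∎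
    where
    open ≡-Reasoning
    reassoc : ∀ w′ k → cond G k * (incid G k w * incid G k w′) ≡ (cond G k * incid G k w) * incid G k w′
    reassoc w′ k = sym (*-assoc (cond G k) (incid G k w) (incid G k w′))

  dot-Lmul : ∀ x y → dot G x (Lmul G y) ≡ energy x y
  dot-Lmul x y = begin
    Σ (λ w → x w * Lmul G y w)
      ≡⟨ Σ-cong (λ w → cong (x w *_) (trans (Lmul≡Σ-grad y w) (Σ-cong (swap w)))) ⟩
    Σ (λ w → x w * Σ (λ k → (cond G k * grad y k) * incid G k w))
      ≡⟨ Σ-incid-swap x (λ k → cond G k * grad y k) ⟩
    Σ (λ k → (cond G k * grad y k) * grad x k)
      ≡⟨ Σ-cong (λ k → xy∙z≈x∙zy (cond G k) (grad y k) (grad x k)) ⟩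
    energy x y ∎
    where
    open ≡-Reasoning
    swap : ∀ w k → (cond G k * incid G k w) * grad y k ≡ (cond G k * grad y k) * incid G k w
    swap w k = xy∙z≈xz∙y (cond G k) (incid G k w) (grad y k)

  flow≡energy : ∀ p A → flow G p A ≡ energy 𝟙[ A ] p
  flow≡energy p A = Σ-cong (λ k → flow-summand (A (u G k)) (A (v G k)) (p (u G k)) (p (v G k)) (cond G k))

  cutConductance≡energy : ∀ A → cutConductance A ≡ energy 𝟙[ A ] 𝟙[ A ]
  cutConductance≡energy A = Σ-cong (λ k → cut-summand (A (u G k)) (A (v G k)) (cond G k))

  dot-shift : ∀ b p D A → dot G b (λ w → p w + D * 𝟙 (A w)) ≡ dot G b p + D * S G b A
  dot-shift b p D A =
    trans (Σ-cong (λ w → expand D (b w) (p w) (𝟙 (A w)))) (Σ-linear (λ w → b w * p w) (λ w → 𝟙 (A w) * b w) D)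
    where
    expand : ∀ D β π a → β * (π + D * a) ≡ β * π + D * (a * β)
    expand = solve-∀ ℚ-ring

  energy-shift : ∀ p D A → let p′ = λ w → p w + D * 𝟙 (A w) in
    energy p′ p′ ≡ energy p p + two * D * energy 𝟙[ A ] p + D * D * energy 𝟙[ A ] 𝟙[ A ]
  energy-shift p D A = begin
    energy p′ p′
      ≡⟨ Σ-cong (λ k → expand D (cond G k) (p (u G k)) (p (v G k)) (𝟙 (A (u G k))) (𝟙 (A (v G k)))) ⟩
    Σ (λ k → (energyAt p p k + two * D * energyAt 𝟙[ A ] p k) + D * D * energyAt 𝟙[ A ] 𝟙[ A ] k)
      ≡⟨ Σ-linear (λ k → energyAt p p k + two * D * energyAt 𝟙[ A ] p k) (energyAt 𝟙[ A ] 𝟙[ A ]) (D * D) ⟩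
    Σ (λ k → energyAt p p k + two * D * energyAt 𝟙[ A ] p k) + D * D * energy 𝟙[ A ] 𝟙[ A ]
      ≡⟨ cong (_+ D * D * energy 𝟙[ A ] 𝟙[ A ]) (Σ-linear (energyAt p p) (energyAt 𝟙[ A ] p) (two * D)) ⟩
    energy p p + two * D * energy 𝟙[ A ] p + D * D * energy 𝟙[ A ] 𝟙[ A ] ∎
    where
    open ≡-Reasoning
    p′ : Fin n → ℚ
    p′ w = p w + D * 𝟙 (A w)
    expand : ∀ D c pu pv au av →
      c * (((pu + D * au) - (pv + D * av)) * ((pu + D * au) - (pv + D * av)))
        ≡ (c * ((pu - pv) * (pu - pv)) + two * D * (c * ((au - av) * (pu - pv))))
          + D * D * (c * ((au - av) * (au - av)))
    expand = solve-∀ ℚ-ring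

  𝓑-shift : ∀ b p D A →
    𝓑 G b (λ w → p w + D * 𝟙 (A w)) ≡ 𝓑 G b p + two * D * (S G b A - flow G p A) - D * D * cutConductance A
  𝓑-shift b p D A = begin
    two * dot G b p′ - dot G p′ (Lmul G p′)
      ≡⟨ cong₂ (λ X Y → two * X - Y) (dot-shift b p D A) (trans (dot-Lmul p′ p′) (energy-shift p D A)) ⟩
    two * (dot G b p + D * S G b A) - (energy p p + two * D * energy 𝟙[ A ] p + D * D * energy 𝟙[ A ] 𝟙[ A ])
      ≡⟨ regroup D (dot G b p) (S G b A) (energy p p) (energy 𝟙[ A ] p) (energy 𝟙[ A ] 𝟙[ A ]) ⟩
    (two * dot G b p - energy p p) + two * D * (S G b A - energy 𝟙[ A ] p) - D * D * energy 𝟙[ A ] 𝟙[ A ]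
      ≡⟨ cong₂ (λ X Y → (two * dot G b p - X) + two * D * (S G b A - Y) - D * D * energy 𝟙[ A ] 𝟙[ A ])
               (sym (dot-Lmul p p)) (sym (flow≡energy p A)) ⟩
    𝓑 G b p + two * D * (S G b A - flow G p A) - D * D * energy 𝟙[ A ] 𝟙[ A ]
      ≡⟨ cong (λ K → 𝓑 G b p + two * D * (S G b A - flow G p A) - D * D * K) (sym (cutConductance≡energy A)) ⟩
    𝓑 G b p + two * D * (S G b A - flow G p A) - D * D * cutConductance A ∎
    where
    open ≡-Reasoning
    p′ : Fin n → ℚ
    p′ w = p w + D * 𝟙 (A w)
    regroup : ∀ D X σ E E₁ E₁₁ → two * (X + D * σ) - (E + two * D * E₁ + D * D * E₁₁)
                               ≡ (two * X - E) + two * D * (σ - E₁) - D * D * E₁₁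
    regroup = solve-∀ ℚ-ring

  module _ {b pstar : Fin n → ℚ} (Lpstar≡b : ∀ w → Lmul G pstar w ≡ b w) where

    S≡energy : ∀ A → S G b A ≡ energy 𝟙[ A ] pstar
    S≡energy A = trans (Σ-cong (λ w → cong (𝟙 (A w) *_) (sym (Lpstar≡b w)))) (dot-Lmul 𝟙[ A ] pstar)

    𝓑≡energy : ∀ p → 𝓑 G b p ≡ two * energy p pstar - energy p p
    𝓑≡energy p = cong₂ (λ X Y → two * X - Y) dot-b≡energy (dot-Lmul p p)
      where
      dot-b≡energy : dot G b p ≡ energy p pstar
      dot-b≡energy = trans (Σ-cong (λ w → trans (*-comm (b w) (p w)) (cong (p w *_) (sym (Lpstar≡b w)))))
                           (dot-Lmul p pstar)

    𝓑-gap : ∀ p → 𝓑 G b pstar - 𝓑 G b p ≡ energy (λ w → pstar w - p w) (λ w → pstar w - p w)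
    𝓑-gap p = begin
      𝓑 G b pstar - 𝓑 G b p
        ≡⟨ cong₂ _-_ (𝓑≡energy pstar) (𝓑≡energy p) ⟩
      (two * energy pstar pstar - energy pstar pstar) - (two * energy p pstar - energy p p)
        ≡⟨ regroup (energy pstar pstar) (energy p pstar) (energy p p) ⟩
      (energy pstar pstar + (- two) * energy p pstar) + energy p p
        ≡⟨ cong (_+ energy p p) (Σ-linear (energyAt pstar pstar) (energyAt p pstar) (- two)) ⟨
      Σ (λ k → energyAt pstar pstar k + (- two) * energyAt p pstar k) + energy p p
        ≡⟨ Σ-distrib-+ (λ k → energyAt pstar pstar k + (- two) * energyAt p pstar k) (energyAt p p) ⟨
      Σ (λ k → (energyAt pstar pstar k + (- two) * energyAt p pstar k) + energyAt p p k)
        ≡⟨ Σ-cong (λ k → expand (cond G k) (pstar (u G k)) (pstar (v G k)) (p (u G k)) (p (v G k))) ⟩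
      energy (λ w → pstar w - p w) (λ w → pstar w - p w) ∎
      where
      open ≡-Reasoning
      regroup : ∀ E⋆⋆ E⋆ E → (two * E⋆⋆ - E⋆⋆) - (two * E⋆ - E) ≡ (E⋆⋆ + (- two) * E⋆) + E
      regroup = solve-∀ ℚ-ring
      expand : ∀ c su sv pu pv →
        (c * ((su - sv) * (su - sv)) + (- two) * (c * ((pu - pv) * (su - sv)))) + c * ((pu - pv) * (pu - pv))
          ≡ c * (((su - pu) - (sv - pv)) * ((su - pu) - (sv - pv)))
      expand = solve-∀ ℚ-ring

    S-flow≡energy : ∀ p A → S G b A - flow G p A ≡ energy 𝟙[ A ] (λ w → pstar w - p w)
    S-flow≡energy p A = begin
      S G b A - flow G p A
        ≡⟨ cong₂ _-_ (S≡energy A) (flow≡energy p A) ⟩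
      energy 𝟙[ A ] pstar - energy 𝟙[ A ] p
        ≡⟨ Σ-distrib-- (energyAt 𝟙[ A ] pstar) (energyAt 𝟙[ A ] p) ⟨
      Σ (λ k → energyAt 𝟙[ A ] pstar k - energyAt 𝟙[ A ] p k)
        ≡⟨ Σ-cong (λ k → expand (cond G k) (grad 𝟙[ A ] k)
                                (pstar (u G k)) (pstar (v G k)) (p (u G k)) (p (v G k))) ⟩
      energy 𝟙[ A ] (λ w → pstar w - p w) ∎
      where
      open ≡-Reasoning
      expand : ∀ c a su sv pu pv → c * (a * (su - sv)) - c * (a * (pu - pv)) ≡ c * (a * ((su - pu) - (sv - pv)))
      expand = solve-∀ ℚ-ring

    𝓑-edgeless : ¬ Fin m → ∀ p → 𝓑 G b p ≡ 0ℚ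
    𝓑-edgeless ¬edge p = trans (𝓑≡energy p) (cong₂ (λ X Y → two * X - Y) (vanish p pstar) (vanish p p))
      where
      vanish : ∀ x y → energy x y ≡ 0ℚ
      vanish x y = Σ-zero (λ k → contradiction k ¬edge)

  module _ (r>0 : ∀ k → 0ℚ < r G k) where

    cond-pos : ∀ k → 0ℚ < cond G k
    cond-pos k = inv-pos (r>0 k)

    cutConductance-nonNeg : ∀ A → 0ℚ ≤ cutConductance A
    cutConductance-nonNeg A = Σ-nonNeg (λ e → *-nonNeg (𝟙-nonNeg (inδ G A e)) (<⇒≤ (cond-pos e)))

-- Cuts of a spanning tree

module TreeCuts {n m : ℕ} (G : Graph n m) (T : EdgeSet m) (tree : SpanningTree G T)
                (C : Fin m → Fin n → Bool) (comp : IsComponentMap G T C) where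
  open Energy G

  C-u : ∀ {k} → T k ≡ true → C k (u G k) ≡ true
  C-u {k} Tk = proj₂ (comp k Tk (u G k)) here

  C-v : ∀ {k} → T k ≡ true → C k (v G k) ≡ false
  C-v {k} Tk with C k (v G k) in Cv
  ... | true  = ⊥-elim (proj₂ tree k Tk (proj₁ (comp k Tk (v G k)) Cv))
  ... | false = refl

  remove-keeps : ∀ {j k} → j ≢ k → T j ≡ true → remove T k j ≡ true
  remove-keeps {j} {k} j≢k Tj with j ≟ᶠ k
  ... | yes j≡k = contradiction j≡k j≢k
  ... | no _    = Tj

  C-closed : ∀ {j k a a′} → T k ≡ true → T j ≡ true → j ≢ k → Joins G j a a′ →
             C k a ≡ true → C k a′ ≡ true
  C-closed {k = k} Tk Tj j≢k joins Ca =
    proj₂ (comp k Tk _) (step _ (proj₁ (comp k Tk _) Ca) (remove-keeps j≢k Tj) joins)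

  C-uniform : ∀ {j k} → T k ≡ true → T j ≡ true → j ≢ k → C k (u G j) ≡ C k (v G j)
  C-uniform Tk Tj j≢k = Bool.⇔→≡ (mk⇔ (C-closed Tk Tj j≢k (inj₁ (refl , refl)))
                                      (C-closed Tk Tj j≢k (inj₂ (refl , refl))))

  grad-𝟙C : ∀ {k} → T k ≡ true → grad 𝟙[ C k ] k ≡ 1ℚ
  grad-𝟙C Tk rewrite C-u Tk | C-v Tk = refl

  grad-𝟙C-other : ∀ {j k} → T k ≡ true → T j ≡ true → j ≢ k → grad 𝟙[ C k ] j ≡ 0ℚ
  grad-𝟙C-other {j} {k} Tk Tj j≢k rewrite C-uniform Tk Tj j≢k = +-inverseʳ (𝟙 (C k (v G j)))

  T-edge-in-cut : ∀ {k} → T k ≡ true → inδ G (C k) k ≡ true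
  T-edge-in-cut Tk rewrite C-u Tk | C-v Tk = refl

  Reach-invariant : (h : Fin n → ℚ) → (∀ j → T j ≡ true → h (u G j) ≡ h (v G j)) →
                    ∀ {a b} → Reach G T a b → h a ≡ h b
  Reach-invariant h h-tree here = refl
  Reach-invariant h h-tree (step j a⇝ Tj (inj₁ (refl , refl))) = trans (Reach-invariant h h-tree a⇝) (h-tree j Tj)
  Reach-invariant h h-tree (step j a⇝ Tj (inj₂ (refl , refl))) = trans (Reach-invariant h h-tree a⇝) (sym (h-tree j Tj))

  grad-determined-by-tree : ∀ x y → (∀ j → T j ≡ true → grad x j ≡ grad y j) → ∀ e → grad x e ≡ grad y e
  grad-determined-by-tree x y agree e =
    swap-middle (x (u G e)) (y (u G e)) (x (v G e)) (y (v G e))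
      (Reach-invariant (λ w → x w - y w) difference-on-tree (proj₁ tree (u G e) (v G e)))
    where
    difference-on-tree : ∀ j → T j ≡ true → x (u G j) - y (u G j) ≡ x (v G j) - y (v G j)
    difference-on-tree j Tj = swap-middle (x (u G j)) (x (v G j)) (y (u G j)) (y (v G j)) (agree j Tj)

  cut-duality : ∀ (s : Fin m → ℚ) {j} → T j ≡ true → Σ (λ k → (𝟙 (T k) * s k) * grad 𝟙[ C k ] j) ≡ s j
  cut-duality s {j} Tj = begin
    Σ (λ k → (𝟙 (T k) * s k) * grad 𝟙[ C k ] j)  ≡⟨ Σ-single _ j off-diagonal ⟩
    (𝟙 (T j) * s j) * grad 𝟙[ C j ] j             ≡⟨ cong₂ (λ t γ → 𝟙 t * s j * γ) Tj (grad-𝟙C Tj) ⟩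
    1ℚ * s j * 1ℚ                                 ≡⟨ trans (*-identityʳ (1ℚ * s j)) (*-identityˡ (s j)) ⟩
    s j                                           ∎
    where
    open ≡-Reasoning
    off-diagonal : ∀ k → k ≢ j → (𝟙 (T k) * s k) * grad 𝟙[ C k ] j ≡ 0ℚ
    off-diagonal k k≢j with T k in Tk
    ... | true  = trans (cong (1ℚ * s k *_) (grad-𝟙C-other Tk Tj (k≢j ∘ sym))) (*-zeroʳ (1ℚ * s k))
    ... | false = trans (cong (_* grad 𝟙[ C k ] j) (*-zeroˡ (s k))) (*-zeroˡ (grad 𝟙[ C k ] j))

  grad-tree-expansion : ∀ x e → grad x e ≡ Σ (λ k → (𝟙 (T k) * grad x k) * grad 𝟙[ C k ] e)
  grad-tree-expansion x e =
    trans (grad-determined-by-tree x y (λ j Tj → sym (trans (grad-y j) (cut-duality (grad x) Tj))) e) (grad-y e)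
    where
    t : Fin m → ℚ
    t k = 𝟙 (T k) * grad x k
    y : Fin n → ℚ
    y w = Σ (λ k → t k * 𝟙 (C k w))
    grad-y : ∀ e → grad y e ≡ Σ (λ k → t k * grad 𝟙[ C k ] e)
    grad-y e = trans (sym (Σ-distrib-- (λ k → t k * 𝟙 (C k (u G e))) (λ k → t k * 𝟙 (C k (v G e)))))
                     (Σ-cong (λ k → sym (x[y-z]≈xy-xz (t k) (𝟙 (C k (u G e))) (𝟙 (C k (v G e))))))

  energy-tree-expansion : ∀ x → energy x x ≡ Σ (λ k → 𝟙 (T k) * (grad x k * energy 𝟙[ C k ] x))
  energy-tree-expansion x = begin
    Σ (λ e → cond G e * (grad x e * grad x e))
      ≡⟨ Σ-cong (λ e → trans (sym (*-assoc (cond G e) (grad x e) (grad x e)))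
                             (cong (cond G e * grad x e *_) (grad-tree-expansion x e))) ⟩
    Σ (λ e → (cond G e * grad x e) * Σ (λ k → t k * grad 𝟙[ C k ] e))
      ≡⟨ Σ-cong (λ e → *-distribˡ-Σ (cond G e * grad x e) (λ k → t k * grad 𝟙[ C k ] e)) ⟩
    Σ (λ e → Σ (λ k → (cond G e * grad x e) * (t k * grad 𝟙[ C k ] e)))
      ≡⟨ Σ-comm (λ e k → (cond G e * grad x e) * (t k * grad 𝟙[ C k ] e)) ⟩
    Σ (λ k → Σ (λ e → (cond G e * grad x e) * (t k * grad 𝟙[ C k ] e)))
      ≡⟨ Σ-cong (λ k → Σ-cong (λ e → rearrange (cond G e) (grad x e) (t k) (grad 𝟙[ C k ] e))) ⟩
    Σ (λ k → Σ (λ e → t k * energyAt 𝟙[ C k ] x e))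
      ≡⟨ Σ-cong (λ k → *-distribˡ-Σ (t k) (energyAt 𝟙[ C k ] x)) ⟨
    Σ (λ k → t k * energy 𝟙[ C k ] x)
      ≡⟨ Σ-cong (λ k → *-assoc (𝟙 (T k)) (grad x k) (energy 𝟙[ C k ] x)) ⟩
    Σ (λ k → 𝟙 (T k) * (grad x k * energy 𝟙[ C k ] x)) ∎
    where
    open ≡-Reasoning
    t : Fin m → ℚ
    t k = 𝟙 (T k) * grad x k
    rearrange : ∀ c g τ γ → (c * g) * (τ * γ) ≡ τ * (c * (γ * g))
    rearrange = solve-∀ ℚ-ring

  treeFlowEnergy : (Fin m → ℚ) → ℚ
  treeFlowEnergy φ = Σ (λ k → 𝟙 (T k) * (r G k * (φ k * φ k)))

  module _ (r>0 : ∀ k → 0ℚ < r G k) where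

    cutConductance-pos : ∀ {k} → T k ≡ true → 0ℚ < cutConductance (C k)
    cutConductance-pos {k} Tk =
      <-≤-trans own-edge (summand≤Σ (λ e → *-nonNeg (𝟙-nonNeg (inδ G (C k) e)) (<⇒≤ (cond-pos r>0 e))) k)
      where
      own-edge : 0ℚ < 𝟙 (inδ G (C k) k) * cond G k
      own-edge rewrite T-edge-in-cut Tk = subst (0ℚ <_) (sym (*-identityˡ (cond G k))) (cond-pos r>0 k)

    energy≤treeFlowEnergy : ∀ x → energy x x ≤ treeFlowEnergy (λ k → energy 𝟙[ C k ] x)
    energy≤treeFlowEnergy x = +-cancelˡ-≤ (energy x x) (begin
      energy x x + energy x x
        ≡⟨ double (energy x x) ⟩
      two * energy x x
        ≡⟨ cong (two *_) (energy-tree-expansion x) ⟩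
      two * Σ (λ k → 𝟙 (T k) * (a k * φ k))
        ≡⟨ *-distribˡ-Σ two (λ k → 𝟙 (T k) * (a k * φ k)) ⟩
      Σ (λ k → two * (𝟙 (T k) * (a k * φ k)))
        ≡⟨ Σ-cong (λ k → x∙yz≈y∙xz two (𝟙 (T k)) (a k * φ k)) ⟩
      Σ (λ k → 𝟙 (T k) * (two * (a k * φ k)))
        ≤⟨ Σ-mono-≤ (λ k → *-monoˡ-≤-nonNeg (𝟙 (T k)) {{nonNegative (𝟙-nonNeg (T k))}}
                             (am-gm (rc≡1 k) (<⇒≤ (r>0 k)) (a k) (φ k))) ⟩
      Σ (λ k → 𝟙 (T k) * (cond G k * (a k * a k) + r G k * (φ k * φ k)))
        ≡⟨ Σ-cong (λ k → *-distribˡ-+ (𝟙 (T k)) (cond G k * (a k * a k)) (r G k * (φ k * φ k))) ⟩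
      Σ (λ k → 𝟙 (T k) * (cond G k * (a k * a k)) + 𝟙 (T k) * (r G k * (φ k * φ k)))
        ≡⟨ Σ-distrib-+ (λ k → 𝟙 (T k) * (cond G k * (a k * a k))) (λ k → 𝟙 (T k) * (r G k * (φ k * φ k))) ⟩
      Σ (λ k → 𝟙 (T k) * (cond G k * (a k * a k))) + treeFlowEnergy φ
        ≤⟨ +-monoˡ-≤ (treeFlowEnergy φ)
             (Σ-mono-≤ (λ k → 𝟙-*-≤ (T k) (*-nonNeg (<⇒≤ (cond-pos r>0 k)) (square-nonNeg (a k))))) ⟩
      energy x x + treeFlowEnergy φ ∎)
      where
      open ≤-Reasoning
      a : Fin m → ℚ
      a = grad x
      φ : Fin m → ℚ
      φ k = energy 𝟙[ C k ] x
      rc≡1 : ∀ k → r G k * cond G k ≡ 1ℚ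
      rc≡1 k = trans (*-comm (r G k) (cond G k)) (inv-inverseˡ (<⇒≢ (r>0 k) ∘ sym))
      double : ∀ q → q + q ≡ two * q
      double = solve-∀ ℚ-ring

-- One step of Dual KOSZ

-- Δ = φR maximises 2Δφ − Δ²K (as RK = 1), with gain φ²R.
optimal-shift : ∀ {R K} → R * K ≡ 1ℚ → ∀ B φ →
  B + two * (φ * R) * φ - (φ * R) * (φ * R) * K ≡ B + R * (φ * φ)
optimal-shift {R} {K} RK≡1 B φ = begin
  B + two * (φ * R) * φ - (φ * R) * (φ * R) * K  ≡⟨ solve (R ∷ K ∷ B ∷ φ ∷ []) ℚ-ring ⟩
  B + R * (φ * φ) * (two - R * K)                ≡⟨ cong (λ z → B + R * (φ * φ) * (two - z)) RK≡1 ⟩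
  B + R * (φ * φ) * (two - 1ℚ)                   ≡⟨ solve (R ∷ B ∷ φ ∷ []) ℚ-ring ⟩
  B + R * (φ * φ)                                ∎
  where open ≡-Reasoning

weighted-gain : ∀ t ι r K B φ → (t ≡ true → 0ℚ < K) →
  let ρ = inv K; π = 𝟙 t * (ι * (r * inv ρ)) in
  π * (B + two * (φ * ρ) * φ - (φ * ρ) * (φ * ρ) * K) ≡ π * B + ι * (𝟙 t * (r * (φ * φ)))
weighted-gain false ι r K B φ _ = vanish ι r (inv (inv K)) (inv K) K B φ
  where
  vanish : ∀ ι r ρ⁻¹ ρ K B φ →
    0ℚ * (ι * (r * ρ⁻¹)) * (B + two * (φ * ρ) * φ - (φ * ρ) * (φ * ρ) * K)
      ≡ 0ℚ * (ι * (r * ρ⁻¹)) * B + ι * (0ℚ * (r * (φ * φ)))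
  vanish = solve-∀ ℚ-ring
weighted-gain true ι r K B φ K>0 = begin
  π * (B + two * (φ * ρ) * φ - (φ * ρ) * (φ * ρ) * K)  ≡⟨ cong (π *_) (optimal-shift (inv-inverseˡ K≢0) B φ) ⟩
  π * (B + ρ * (φ * φ))                                ≡⟨ *-distribˡ-+ π B (ρ * (φ * φ)) ⟩
  π * B + π * (ρ * (φ * φ))                            ≡⟨ cong (π * B +_) (regroup ι r (inv ρ) ρ (φ * φ)) ⟩
  π * B + ι * (1ℚ * (r * (φ * φ))) * (inv ρ * ρ)
    ≡⟨ cong (λ z → π * B + ι * (1ℚ * (r * (φ * φ))) * z) (inv-inverseˡ ρ≢0) ⟩
  π * B + ι * (1ℚ * (r * (φ * φ))) * 1ℚ                ≡⟨ cong (π * B +_) (*-identityʳ _) ⟩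
  π * B + ι * (1ℚ * (r * (φ * φ)))                     ∎
  where
  open ≡-Reasoning
  ρ : ℚ
  ρ = inv K
  π : ℚ
  π = 1ℚ * (ι * (r * inv ρ))
  K≢0 : K ≢ 0ℚ
  K≢0 = <⇒≢ (K>0 refl) ∘ sym
  ρ≢0 : ρ ≢ 0ℚ
  ρ≢0 = <⇒≢ (inv-pos (K>0 refl)) ∘ sym
  regroup : ∀ ι r ρ⁻¹ ρ X → 1ℚ * (ι * (r * ρ⁻¹)) * (ρ * X) ≡ ι * (1ℚ * (r * X)) * (ρ⁻¹ * ρ)
  regroup = solve-∀ ℚ-ring

tree-edge-or-edgeless : ∀ {n m} (G : Graph n m) (T : EdgeSet m) →
  (∀ k → u G k ≢ v G k) → (∀ x y → Reach G T x y) → (∃ λ k → T k ≡ true) ⊎ ¬ Fin m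
tree-edge-or-edgeless G T no-loops spans with any? (λ k → T k Bool.≟ true)
... | yes tree-edge    = inj₁ tree-edge
... | no no-tree-edge = inj₂ (λ e → no-loops e (trivial (spans (u G e) (v G e))))
  where
  trivial : ∀ {a b} → Reach G T a b → a ≡ b
  trivial here             = refl
  trivial (step k _ Tk _) = contradiction (k , Tk) no-tree-edge

module DualKOSZStep {n m : ℕ} (G : Graph n m) (no-loops : ∀ k → u G k ≢ v G k) (r>0 : ∀ k → 0ℚ < r G k)
                    {b pstar : Fin n → ℚ} (Lpstar≡b : ∀ w → Lmul G pstar w ≡ b w)
                    (T : EdgeSet m) (tree : SpanningTree G T)
                    (C : Fin m → Fin n → Bool) (comp : IsComponentMap G T C) where
  open Energy G
  open TreeCuts G T tree C comp

  τ-summand-nonNeg : ∀ k → 0ℚ ≤ 𝟙 (T k) * (r G k * inv (R G (C k)))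
  τ-summand-nonNeg k =
    *-nonNeg (𝟙-nonNeg (T k)) (*-nonNeg (<⇒≤ (r>0 k)) (inv-nonNeg (inv-nonNeg (cutConductance-nonNeg r>0 (C k)))))

  τ-nonNeg : 0ℚ ≤ τ G T C
  τ-nonNeg = Σ-nonNeg τ-summand-nonNeg

  τ⁻¹τ≡1 : ∀ {k} → T k ≡ true → inv (τ G T C) * τ G T C ≡ 1ℚ
  τ⁻¹τ≡1 {k} Tk = inv-inverseˡ (<⇒≢ (<-≤-trans own-summand (summand≤Σ τ-summand-nonNeg k)) ∘ sym)
    where
    own-summand : 0ℚ < 𝟙 (T k) * (r G k * inv (R G (C k)))
    own-summand rewrite Tk =
      subst (0ℚ <_) (sym (*-identityˡ _)) (*-pos (r>0 k) (inv-pos (inv-pos (cutConductance-pos r>0 Tk))))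

  ΣP≡τ⁻¹τ : Σ (P G T C) ≡ inv (τ G T C) * τ G T C
  ΣP≡τ⁻¹τ = trans (Σ-cong (λ k → x∙yz≈y∙xz (𝟙 (T k)) (inv (τ G T C)) (r G k * inv (R G (C k)))))
                  (sym (*-distribˡ-Σ (inv (τ G T C)) (λ k → 𝟙 (T k) * (r G k * inv (R G (C k))))))

  -- Without tree edges τ = 0 and inv τ is the junk value 0; but then G has no edges and 𝓑 vanishes.
  τ⁻¹τ-absorbs : ∀ p → inv (τ G T C) * τ G T C * 𝓑 G b p ≡ 𝓑 G b p
  τ⁻¹τ-absorbs p with tree-edge-or-edgeless G T no-loops (proj₁ tree)
  ... | inj₁ (k , Tk) = trans (cong (_* 𝓑 G b p) (τ⁻¹τ≡1 Tk)) (*-identityˡ (𝓑 G b p))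
  ... | inj₂ edgeless rewrite 𝓑-edgeless Lpstar≡b edgeless p = *-zeroʳ (inv (τ G T C) * τ G T C)

  expectedB≡ : ∀ p → expectedB G T C b p
    ≡ 𝓑 G b p + inv (τ G T C) * treeFlowEnergy (λ k → energy 𝟙[ C k ] (λ w → pstar w - p w))
  expectedB≡ p = begin
    Σ (λ k → P G T C k * 𝓑 G b (update G T C b p k))
      ≡⟨ Σ-cong (λ k → trans (cong (P G T C k *_) (𝓑-shift b p (Δ G T C b p k) (C k)))
                             (weighted-gain (T k) ι (r G k) (cutConductance (C k)) (𝓑 G b p) (φ k)
                                            (cutConductance-pos r>0))) ⟩
    Σ (λ k → P G T C k * 𝓑 G b p + ι * (𝟙 (T k) * (r G k * (φ k * φ k))))
      ≡⟨ Σ-linear (λ k → P G T C k * 𝓑 G b p) (λ k → 𝟙 (T k) * (r G k * (φ k * φ k))) ι ⟩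
    Σ (λ k → P G T C k * 𝓑 G b p) + ι * treeFlowEnergy φ
      ≡⟨ cong₂ (λ X Y → X + ι * Y) ΣP𝓑≡τ⁻¹τ𝓑
               (Σ-cong (λ k → cong (λ z → 𝟙 (T k) * (r G k * (z * z))) (φ≡ψ k))) ⟩
    ι * τ G T C * 𝓑 G b p + ι * treeFlowEnergy ψ
      ≡⟨ cong (_+ ι * treeFlowEnergy ψ) (τ⁻¹τ-absorbs p) ⟩
    𝓑 G b p + ι * treeFlowEnergy ψ ∎
    where
    open ≡-Reasoning
    ι : ℚ
    ι = inv (τ G T C)
    φ ψ : Fin m → ℚ
    φ k = S G b (C k) - flow G p (C k)
    ψ k = energy 𝟙[ C k ] (λ w → pstar w - p w)
    φ≡ψ : ∀ k → φ k ≡ ψ k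
    φ≡ψ k = S-flow≡energy Lpstar≡b p (C k)
    ΣP𝓑≡τ⁻¹τ𝓑 : Σ (λ k → P G T C k * 𝓑 G b p) ≡ ι * τ G T C * 𝓑 G b p
    ΣP𝓑≡τ⁻¹τ𝓑 = trans (sym (*-distribʳ-Σ (𝓑 G b p) (P G T C))) (cong (_* 𝓑 G b p) ΣP≡τ⁻¹τ)

lemma4 : ∀ {n m : ℕ} (G : Graph n m)
    → (∀ k → u G k ≢ v G k)
    → (∀ k l → k ≢ l → ¬ Joins G l (u G k) (v G k))
    → (∀ k → 0ℚ < r G k)
    → Connected G
    → (b : Fin n → ℚ) → Σ b ≡ 0ℚ
    → (pstar : Fin n → ℚ) → (∀ w → Lmul G pstar w ≡ b w)
    → (T : EdgeSet m) → SpanningTree G T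
    → (C : Fin m → Fin n → Bool) → IsComponentMap G T C
    → (pt : Fin n → ℚ)
    → 𝓑 G b pstar - expectedB G T C b pt
        ≤ (1ℚ - inv (τ G T C)) * (𝓑 G b pstar - 𝓑 G b pt)
lemma4 {n} G no-loops _ r>0 _ b _ pstar Lpstar≡b T tree C comp pt = begin
  𝓑 G b pstar - expectedB G T C b pt    ≡⟨ cong (λ E → 𝓑 G b pstar - E) (expectedB≡ pt) ⟩
  𝓑 G b pstar - (𝓑 G b pt + ι * Φ)      ≡⟨ regroup (𝓑 G b pstar) (𝓑 G b pt) (ι * Φ) ⟩
  (𝓑 G b pstar - 𝓑 G b pt) - ι * Φ      ≤⟨ contraction (inv-nonNeg τ-nonNeg) gap≤Φ ⟩
  (1ℚ - ι) * (𝓑 G b pstar - 𝓑 G b pt)  ∎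
  where
  open ≤-Reasoning
  open Energy G
  open TreeCuts G T tree C comp
  open DualKOSZStep G no-loops r>0 Lpstar≡b T tree C comp
  ι : ℚ
  ι = inv (τ G T C)
  x : Fin n → ℚ
  x w = pstar w - pt w
  Φ : ℚ
  Φ = treeFlowEnergy (λ k → energy 𝟙[ C k ] x)
  gap≤Φ : 𝓑 G b pstar - 𝓑 G b pt ≤ Φ
  gap≤Φ = ≤-trans (≤-reflexive (𝓑-gap Lpstar≡b pt)) (energy≤treeFlowEnergy r>0 x)
  regroup : ∀ a c d → a - (c + d) ≡ (a - c) - d
  regroup = solve-∀ ℚ-ring
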